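{- For a subpermutation $s$ and any core element $(i, j, v) \in \mathrm{core}(M^s)$, we have $i \le j$.
   Context: A sequence $s[0],\dots,s[n-1]$ is a subpermutation if each $s[i]\in\{0,\dots,n-1\}\cup\{\star\}$ (where $\star$ is a placeholder symbol) and the subsequence $s^*$ of non-placeholder elements is a permutation of $\{0,\dots,|s^*|-1\}$. The alignment graph $G^s$ is the edge-weighted directed graph with vertex set $\{0,\dots,n\}\times\{0,\dots,|s^*|\}$ and edges: $(x,y)\to(x,y+1)$ of weight $0$ for $y<|s^*|$; $(x,y)\to(x+1,y)$ of weight $0$ for $x<n$; $(i,s[i])\to(i+1,s[i]+1)$ of weight $1$ for each $i$ with $s[i]\ne\star$; and $(x,y)\to(x-1,y)$ of weight $-2$ for $x>0$. $M^s$ is the $(n+1)\times(n+1)$ matrix (indexed from $0$) with $M^s_{i,j}$ the length of the longest path in $G^s$ from $(i,0)$ to $(j,|s^*|)$. For a matrix $M$, $M^{\square}_{i,j}=M_{i,j+1}+M_{i+1,j}-M_{i,j}-M_{i+1,j+1}$ and $\mathrm{core}(M)=\{(i,j,M^{\square}_{i,j}) : M^{\square}_{i,j}\ne 0\}$. -}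

module Defs where

open import Data.Nat using (ℕ; zero; suc; _≤_; _<_)
open import Data.Integer using (ℤ; +_; -_; _+_; _-_)
open import Data.Fin using (Fin; toℕ)
open import Data.Vec using (Vec; lookup; toList)
open import Data.Maybe using (Maybe; just; nothing)
open import Data.List using (List; length; upTo; catMaybes)
open import Data.List.Relation.Unary.All using (All)
open import Data.List.Relation.Binary.Permutation.Propositional using (_↭_)
open import Data.Product using (_×_; _,_; Σ)
open import Relation.Binary.PropositionalEquality using (_≡_)

-- A sequence s[0..n-1] with entries in ℕ ∪ {⋆}; ⋆ is represented by nothing.
-- s* : the subsequence of non-placeholder elements.
star : ∀ {n} → Vec (Maybe ℕ) n → List ℕ
star s = catMaybes (toList s)

starLen : ∀ {n} → Vec (Maybe ℕ) n → ℕ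
starLen s = length (star s)

IsSubperm : ∀ {n} → Vec (Maybe ℕ) n → Set
IsSubperm {n} s = All (λ k → k < n) (star s) × (star s ↭ upTo (starLen s))

Vertex : Set
Vertex = ℕ × ℕ

data Edge {n : ℕ} (s : Vec (Maybe ℕ) n) : Vertex → Vertex → ℤ → Set where
  up    : ∀ {x y} → x ≤ n → y < starLen s → Edge s (x , y) (x , suc y) (+ 0)
  right : ∀ {x y} → x < n → y ≤ starLen s → Edge s (x , y) (suc x , y) (+ 0)
  diag  : ∀ (i : Fin n) {k} → lookup s i ≡ just k →
          Edge s (toℕ i , k) (suc (toℕ i) , suc k) (+ 1)
  left  : ∀ {x y} → suc x ≤ n → y ≤ starLen s → Edge s (suc x , y) (x , y) (- (+ 2))

data Path {n : ℕ} (s : Vec (Maybe ℕ) n) : Vertex → Vertex → ℤ → Set where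
  []  : ∀ {u} → Path s u u (+ 0)
  _∷_ : ∀ {u v w a b} → Edge s u v a → Path s v w b → Path s u w (a + b)

IsLongestPathMatrix : ∀ {n} → Vec (Maybe ℕ) n → (ℕ → ℕ → ℤ) → Set
IsLongestPathMatrix {n} s M =
  ∀ i j → i ≤ n → j ≤ n →
    Path s (i , 0) (j , starLen s) (M i j) ×
    (∀ {w} → Path s (i , 0) (j , starLen s) w → w Data.Integer.≤ M i j)

box : (ℕ → ℕ → ℤ) → ℕ → ℕ → ℤ
box M i j = (M i (suc j) + M (suc i) j) - (M i j + M (suc i) (suc j))

{-# OPTIONS --safe #-}
module Submission where

-- The weights of G^s are dominated by the potential 2x: no edge gains more
-- weight than it raises 2x, and left and up edges are tight.  So every path
-- from (i,0) to (j,|s*|) weighs at most 2j - 2i, and for j ≤ i this is attained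
-- by walking left along the bottom row and then straight up.  Hence
-- M^s_{i,j} = 2j - 2i on and below the diagonal, a matrix of the form f j - g i,
-- whose box differences vanish; a nonzero core entry must lie above the diagonal.

open import Defs
open import Data.Nat using (ℕ; zero; suc; _+_; _≤_; _<_; z≤n; s≤s; _≤′_; ≤′-refl; ≤′-step; _≤?_)
open import Data.Nat.Properties using (≤⇒≤′; ≤-trans; n≤1+n; m≤n⇒m≤1+n; <⇒≤; ≰⇒>; +-identityʳ; +-suc; m≤n+m)
open import Data.Integer using (ℤ; +_; -_; _-_; +≤+) renaming (_+_ to _+ℤ_; _≤_ to _≤ℤ_)
open import Data.Integer.Properties using (+-comm; +-inverseʳ; +-minus-telescope; +-mono-≤; ≤-antisym; module ≤-Reasoning)
  renaming (≤-reflexive to ≤ℤ-reflexive)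
open import Data.Integer.Tactic.RingSolver using (solve-∀)
open import Data.Fin using (toℕ)
open import Data.Vec using (Vec)
open import Data.Maybe using (Maybe)
open import Data.Product using (_,_; proj₁; proj₂)
open import Relation.Binary.PropositionalEquality using (_≡_; refl; sym; trans; cong; subst; module ≡-Reasoning)
open import Relation.Nullary using (¬_; yes; no; contradiction)

potential : ℕ → ℤ
potential x = + x +ℤ + x

-- The solver treats + (suc x) as an atom; over X = + x the sides reduce to the goal.
potential-rise : ∀ x → potential (suc x) - potential x ≡ + 2
potential-rise x = rise (+ x)
  where
  rise : ∀ X → ((+ 1 +ℤ X) +ℤ (+ 1 +ℤ X)) - (X +ℤ X) ≡ + 2
  rise = solve-∀

potential-fall : ∀ x → potential x - potential (suc x) ≡ - + 2
potential-fall x = fall (+ x)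
  where
  fall : ∀ X → (X +ℤ X) - ((+ 1 +ℤ X) +ℤ (+ 1 +ℤ X)) ≡ - + 2
  fall = solve-∀

box-difference : ∀ (f g : ℕ → ℤ) i j → box (λ a b → f b - g a) i j ≡ + 0
box-difference f g i j = cancel (f (suc j)) (f j) (g i) (g (suc i))
  where
  cancel : ∀ a b c d → ((a - c) +ℤ (b - d)) - ((b - c) +ℤ (a - d)) ≡ + 0
  cancel = solve-∀

box-vanishes-below-diagonal : ∀ (M : ℕ → ℕ → ℤ) (f g : ℕ → ℤ) {n} →
  (∀ {a b} → b ≤ a → a ≤ n → M a b ≡ f b - g a) →
  ∀ {i j} → j < i → i < n → box M i j ≡ + 0
box-vanishes-below-diagonal M f g M≡f-g {i = i} {j} j<i i<n = begin
  box M i j                      ≡⟨ cong₄ (λ p q r t → (p +ℤ q) - (r +ℤ t))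
                                      (M≡f-g j<i (<⇒≤ i<n))
                                      (M≡f-g (≤-trans (n≤1+n j) (m≤n⇒m≤1+n j<i)) i<n)
                                      (M≡f-g (<⇒≤ j<i) (<⇒≤ i<n))
                                      (M≡f-g (s≤s (<⇒≤ j<i)) i<n) ⟩
  box (λ a b → f b - g a) i j    ≡⟨ box-difference f g i j ⟩
  + 0                            ∎
  where
  open ≡-Reasoning
  cong₄ : ∀ (h : ℤ → ℤ → ℤ → ℤ → ℤ) {p p' q q' r r' t t'} →
    p ≡ p' → q ≡ q' → r ≡ r' → t ≡ t' → h p q r t ≡ h p' q' r' t'
  cong₄ h refl refl refl refl = refl

module _ {n : ℕ} (s : Vec (Maybe ℕ) n) where

  edge-weight≤potential-rise : ∀ {x y x' y' a} → Edge s (x , y) (x' , y') a →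
    a ≤ℤ potential x' - potential x
  edge-weight≤potential-rise (up {x} _ _) = ≤ℤ-reflexive (sym (+-inverseʳ (potential x)))
  edge-weight≤potential-rise (right {x} _ _) =
    subst (+ 0 ≤ℤ_) (sym (potential-rise x)) (+≤+ z≤n)
  edge-weight≤potential-rise (diag i _) =
    subst (+ 1 ≤ℤ_) (sym (potential-rise (toℕ i))) (+≤+ (s≤s z≤n))
  edge-weight≤potential-rise (left {x} _ _) = ≤ℤ-reflexive (sym (potential-fall x))

  path-weight≤potential-rise : ∀ {x y x' y' w} → Path s (x , y) (x' , y') w →
    w ≤ℤ potential x' - potential x
  path-weight≤potential-rise {x} [] = ≤ℤ-reflexive (sym (+-inverseʳ (potential x)))
  path-weight≤potential-rise {x} {x' = x'} (_∷_ {v = (x₁ , _)} {a = a} {b} e p) = begin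
    a +ℤ b
      ≡⟨ +-comm a b ⟩
    b +ℤ a
      ≤⟨ +-mono-≤ (path-weight≤potential-rise p) (edge-weight≤potential-rise e) ⟩
    (potential x' - potential x₁) +ℤ (potential x₁ - potential x)
      ≡⟨ +-minus-telescope (potential x') (potential x₁) (potential x) ⟩
    potential x' - potential x
      ∎
    where open ≤-Reasoning

  climb-column : ∀ {x} → x ≤ n → ∀ k {y} → k + y ≡ starLen s → Path s (x , y) (x , starLen s) (+ 0)
  climb-column x≤n zero    refl = []
  climb-column x≤n (suc k) {y} k+y≡top =
    up x≤n (subst (y <_) k+y≡top (s≤s (m≤n+m y k))) ∷ climb-column x≤n k (trans (+-suc k y) k+y≡top)

  left-then-up : ∀ {x x'} → x ≤′ x' → x' ≤ n →
    Path s (x' , 0) (x , starLen s) (potential x - potential x')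
  left-then-up {x} ≤′-refl x≤n =
    subst (Path s _ _) (sym (+-inverseʳ (potential x))) (climb-column x≤n (starLen s) (+-identityʳ _))
  left-then-up {x} (≤′-step {x''} x≤′x'') x'≤n =
    subst (Path s _ _) weight (left x'≤n z≤n ∷ left-then-up x≤′x'' (≤-trans (n≤1+n x'') x'≤n))
    where
    open ≡-Reasoning
    weight : - + 2 +ℤ (potential x - potential x'') ≡ potential x - potential (suc x'')
    weight = begin
      - + 2 +ℤ (potential x - potential x'')
        ≡⟨ +-comm (- + 2) (potential x - potential x'') ⟩
      (potential x - potential x'') +ℤ - + 2
        ≡⟨ cong (potential x - potential x'' +ℤ_) (sym (potential-fall x'')) ⟩
      (potential x - potential x'') +ℤ (potential x'' - potential (suc x''))
        ≡⟨ +-minus-telescope (potential x) (potential x'') (potential (suc x'')) ⟩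
      potential x - potential (suc x'')
        ∎

  longest-path-below-diagonal : ∀ {M} → IsLongestPathMatrix s M →
    ∀ {i j} → j ≤ i → i ≤ n → M i j ≡ potential j - potential i
  longest-path-below-diagonal longest {i} {j} j≤i i≤n = ≤-antisym
    (path-weight≤potential-rise (proj₁ (longest i j i≤n (≤-trans j≤i i≤n))))
    (proj₂ (longest i j i≤n (≤-trans j≤i i≤n)) (left-then-up (≤⇒≤′ j≤i) i≤n))

corollary5p8 : (n : ℕ) (s : Vec (Maybe ℕ) n) → IsSubperm s →
    (M : ℕ → ℕ → ℤ) → IsLongestPathMatrix s M →
    (i j : ℕ) → i < n → j < n → ¬ (box M i j ≡ + 0) → i ≤ j
corollary5p8 n s _ M longest i j i<n _ box≢0 with i ≤? j
... | yes i≤j = i≤j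
... | no  i≰j = contradiction
  (box-vanishes-below-diagonal M potential potential (longest-path-below-diagonal s longest) (≰⇒> i≰j) i<n)
  box≢0
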